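{- Let $p$ be an odd prime. If $d,u,v$ are positive integers with $\frac{4}{p}=\frac{1}{duv}+\frac{1}{dup}+\frac{1}{dvp}$, then $d\le\left\lfloor\frac{p+3}{8}\right\rfloor$. This bound is optimal, i.e. equality $d=\left\lfloor\frac{p+3}{8}\right\rfloor$ occurs for some odd prime $p$ having a solution of this form. -}

module Defs where

open import Data.Nat using (ℕ; _*_; _<_; NonZero; >-nonZero)
open import Data.Nat.Properties using (m*n≢0)
open import Data.Integer using (+_)
open import Data.Rational using (ℚ; _/_; _+_)
open import Relation.Binary.PropositionalEquality using (_≡_)

-- The equation  4/p = 1/(duv) + 1/(dup) + 1/(dvp)  in ℚ, for positive p, d, u, v
-- (the positivity proofs are needed only to form the fractions).
ErdosStrausEq : (p d u v : ℕ) → 0 < p → 0 < d → 0 < u → 0 < v → Set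
ErdosStrausEq p d u v p>0 d>0 u>0 v>0 =
  (+ 4 / p) ≡ (+ 1 / (d * u * v)) + (+ 1 / (d * u * p)) + (+ 1 / (d * v * p))
  where
  instance
    nzp : NonZero p
    nzp = >-nonZero p>0
    nzd : NonZero d
    nzd = >-nonZero d>0
    nzu : NonZero u
    nzu = >-nonZero u>0
    nzv : NonZero v
    nzv = >-nonZero v>0
    nzdu : NonZero (d * u)
    nzdu = m*n≢0 d u
    nzdv : NonZero (d * v)
    nzdv = m*n≢0 d v
    nzduv : NonZero (d * u * v)
    nzduv = m*n≢0 (d * u) v
    nzdup : NonZero (d * u * p)
    nzdup = m*n≢0 (d * u) p
    nzdvp : NonZero (d * v * p)
    nzdvp = m*n≢0 (d * v) p

{-# OPTIONS --safe #-}
-- Clearing denominators turns the equation into 4duv = p + u + v. If u = v = 1 this says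
-- p = 4d - 2, which is even. Otherwise uv ≥ 2, and the two instances (u - 1)(v - 1) ≥ 0 and
-- (4d - 1)(uv - 2) ≥ 0 of  k m + n ≤ m n + k  give 8d + u + v ≤ 4duv + 3 = p + u + v + 3.
module Submission where

open import Defs
open import Data.Nat using (ℕ; _+_; _≤_; _<_; _/_)
open import Data.Nat.Primality using (Prime)
open import Data.Product using (_×_; Σ; ∃-syntax)
open import Relation.Binary.PropositionalEquality using (_≡_; _≢_)

open import Data.Nat using (suc; _*_; NonZero; z<s)
open import Data.Nat.Properties
open import Data.Nat.DivMod using (m*n/n≡m; /-monoˡ-≤)
open import Data.Nat.Divisibility using (_∣_; divides; ∣-refl; ∣m+n∣m⇒∣n)
open import Data.Nat.Primality using (prime?; prime⇒irreducible)
open import Data.Nat.Tactic.RingSolver using (solve-∀; solve)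
open import Data.Integer using (+_)
open import Data.Integer.Properties using (+-injective; pos-*)
open import Data.List using ([]; _∷_)
open import Data.Product using (_,_)
import Data.Rational as ℚ
open import Data.Rational.Properties using (toℚᵘ-fromℚᵘ; toℚᵘ-homo-+)
import Data.Rational.Unnormalised as ℚᵘ
open import Data.Rational.Unnormalised using (*≡*)
open import Data.Rational.Unnormalised.Properties using (≃-refl; +-cong; module ≃-Reasoning)
open import Data.Sum using (inj₁; inj₂)
open import Relation.Binary.PropositionalEquality using (refl; sym; trans; cong; subst; module ≡-Reasoning)
open import Relation.Nullary.Decidable using (from-yes)
open import Relation.Nullary.Negation using (contradiction)

toℚᵘ-/ : ∀ m n .{{_ : NonZero n}} → ℚ.toℚᵘ (+ m ℚ./ n) ℚᵘ.≃ + m ℚᵘ./ n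
toℚᵘ-/ m (suc n) = toℚᵘ-fromℚᵘ (+ m ℚᵘ./ suc n)

unitFractions-crossMultiply : ∀ m n a b c .{{_ : NonZero n}} .{{_ : NonZero a}} .{{_ : NonZero b}} .{{_ : NonZero c}} →
  + m ℚ./ n ≡ + 1 ℚ./ a ℚ.+ + 1 ℚ./ b ℚ.+ + 1 ℚ./ c → m * (a * b * c) ≡ n * (b * c + a * c + a * b)
unitFractions-crossMultiply m n@(suc _) a@(suc _) b@(suc _) c@(suc _) eq = crossMultiplied inℚᵘ
  where
  inℚᵘ : + m ℚᵘ./ n ℚᵘ.≃ + 1 ℚᵘ./ a ℚᵘ.+ + 1 ℚᵘ./ b ℚᵘ.+ + 1 ℚᵘ./ c
  inℚᵘ = begin
    + m ℚᵘ./ n                                             ≈⟨ toℚᵘ-/ m n ⟨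
    ℚ.toℚᵘ (+ m ℚ./ n)                                     ≡⟨ cong ℚ.toℚᵘ eq ⟩
    ℚ.toℚᵘ (x ℚ.+ y ℚ.+ z)                                 ≈⟨ toℚᵘ-homo-+ (x ℚ.+ y) z ⟩
    ℚ.toℚᵘ (x ℚ.+ y) ℚᵘ.+ ℚ.toℚᵘ z                         ≈⟨ +-cong (toℚᵘ-homo-+ x y) (toℚᵘ-/ 1 c) ⟩
    ℚ.toℚᵘ x ℚᵘ.+ ℚ.toℚᵘ y ℚᵘ.+ + 1 ℚᵘ./ c                 ≈⟨ +-cong (+-cong (toℚᵘ-/ 1 a) (toℚᵘ-/ 1 b)) ≃-refl ⟩
    + 1 ℚᵘ./ a ℚᵘ.+ + 1 ℚᵘ./ b ℚᵘ.+ + 1 ℚᵘ./ c             ∎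
    where
    open ≃-Reasoning
    x = + 1 ℚ./ a
    y = + 1 ℚ./ b
    z = + 1 ℚ./ c

  -- Since n, a, b, c are successors, eqℤ computes to
  -- + m * + (a * b * c) ≡ + (((1 * b + 1 * a) * c + 1 * (a * b)) * n).
  crossMultiplied : + m ℚᵘ./ n ℚᵘ.≃ + 1 ℚᵘ./ a ℚᵘ.+ + 1 ℚᵘ./ b ℚᵘ.+ + 1 ℚᵘ./ c →
                    m * (a * b * c) ≡ n * (b * c + a * c + a * b)
  crossMultiplied (*≡* eqℤ) = trans (+-injective (trans (pos-* m (a * b * c)) eqℤ)) (normalise a b c n)
    where
    normalise : ∀ a b c n → ((1 * b + 1 * a) * c + 1 * (a * b)) * n ≡ n * (b * c + a * c + a * b)
    normalise = solve-∀

k*m+n≤m*n+k : ∀ {k m n} → 0 < m → k ≤ n → k * m + n ≤ m * n + k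
k*m+n≤m*n+k {k} {suc a} {n} _ k≤n with m≤n⇒∃[o]m+o≡n k≤n
... | b , refl = subst (k * suc a + (k + b) ≤_) (sym (expand k a b)) (m≤m+n (k * suc a + (k + b)) (a * b))
  where
  expand : ∀ k a b → suc a * (k + b) + k ≡ k * suc a + (k + b) + a * b
  expand = solve-∀

even-prime : ∀ {p} → Prime p → 2 ∣ p → p ≡ 2
even-prime pr 2∣p with prime⇒irreducible pr 2∣p
... | inj₂ 2≡p = sym 2≡p

m*n≤o⇒m≤o/n : ∀ m {n o} .{{_ : NonZero n}} → m * n ≤ o → m ≤ o / n
m*n≤o⇒m≤o/n m {n} {o} m*n≤o = begin
  m          ≡⟨ m*n/n≡m m n ⟨
  m * n / n  ≤⟨ /-monoˡ-≤ n m*n≤o ⟩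
  o / n      ∎
  where open ≤-Reasoning

ErdosStrausEq⇒4duv≡p+u+v : ∀ {p d u v} (p>0 : 0 < p) (d>0 : 0 < d) (u>0 : 0 < u) (v>0 : 0 < v) →
                            ErdosStrausEq p d u v p>0 d>0 u>0 v>0 → 4 * d * u * v ≡ p + u + v
-- Matching on z<s makes p, d, u, v and their products successors, so their NonZero instances are found.
ErdosStrausEq⇒4duv≡p+u+v {p} {d} {u} {v} z<s z<s z<s z<s eq =
  *-cancelˡ-≡ (4 * d * u * v) (p + u + v) (d * d * u * v * p * p) (begin
    d * d * u * v * p * p * (4 * d * u * v)
      ≡⟨ factorˡ d u v p ⟩
    4 * (d * u * v * (d * u * p) * (d * v * p))
      ≡⟨ unitFractions-crossMultiply 4 p (d * u * v) (d * u * p) (d * v * p) eq ⟩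
    p * (d * u * p * (d * v * p) + d * u * v * (d * v * p) + d * u * v * (d * u * p))
      ≡⟨ factorʳ d u v p ⟩
    d * d * u * v * p * p * (p + u + v)
      ∎)
  where
  open ≡-Reasoning
  factorˡ : ∀ d u v p → d * d * u * v * p * p * (4 * d * u * v) ≡ 4 * (d * u * v * (d * u * p) * (d * v * p))
  factorˡ = solve-∀
  factorʳ : ∀ d u v p → p * (d * u * p * (d * v * p) + d * u * v * (d * v * p) + d * u * v * (d * u * p)) ≡ d * d * u * v * p * p * (p + u + v)
  factorʳ = solve-∀

4duv≡p+u+v⇒8d≤p+3 : ∀ {p d u v} → Prime p → p ≢ 2 → 0 < d → 0 < u → 0 < v → 4 * d * u * v ≡ p + u + v → 8 * d ≤ p + 3
4duv≡p+u+v⇒8d≤p+3 {p} {d} {u} {v} pr p≢2 d>0 u>0 v>0 eq with m≤n⇒m<n∨m≡n (*-mono-< u>0 v>0)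
... | inj₂ 1≡uv
  with refl ← m*n≡1⇒m≡1 u v (sym 1≡uv) | refl ← m*n≡1⇒n≡1 u v (sym 1≡uv) =
  contradiction (even-prime pr 2∣p) p≢2
  where
  open ≡-Reasoning
  2∣p : 2 ∣ p
  2∣p = ∣m+n∣m⇒∣n (divides (2 * d) (begin
    2 + p          ≡⟨ solve (p ∷ []) ⟩
    p + 1 + 1      ≡⟨ eq ⟨
    4 * d * 1 * 1  ≡⟨ solve (d ∷ []) ⟩
    2 * d * 2      ∎)) ∣-refl
... | inj₁ 1<uv = +-cancelʳ-≤ (u + v) (8 * d) (p + 3) (begin
  8 * d + (u + v)          ≡⟨ solve (d ∷ u ∷ v ∷ []) ⟩
  8 * d + (1 * u + v)      ≤⟨ +-monoʳ-≤ (8 * d) (k*m+n≤m*n+k u>0 v>0) ⟩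
  8 * d + (u * v + 1)      ≡⟨ solve (d ∷ u ∷ v ∷ []) ⟩
  2 * (4 * d) + u * v + 1  ≤⟨ +-monoˡ-≤ 1 (k*m+n≤m*n+k (*-monoʳ-< 4 d>0) 1<uv) ⟩
  4 * d * (u * v) + 2 + 1  ≡⟨ solve (d ∷ u ∷ v ∷ []) ⟩
  4 * d * u * v + 3        ≡⟨ cong (_+ 3) eq ⟩
  p + u + v + 3            ≡⟨ solve (p ∷ u ∷ v ∷ []) ⟩
  p + 3 + (u + v)          ∎)
  where open ≤-Reasoning

ErdosStrausEq⇒d≤[p+3]/8 : ∀ {p d u v} → Prime p → p ≢ 2 → (p>0 : 0 < p) (d>0 : 0 < d) (u>0 : 0 < u) (v>0 : 0 < v) →
                          ErdosStrausEq p d u v p>0 d>0 u>0 v>0 → d ≤ (p + 3) / 8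
ErdosStrausEq⇒d≤[p+3]/8 {p} {d} pr p≢2 p>0 d>0 u>0 v>0 eq =
  m*n≤o⇒m≤o/n d (subst (_≤ p + 3) (*-comm 8 d)
    (4duv≡p+u+v⇒8d≤p+3 pr p≢2 d>0 u>0 v>0 (ErdosStrausEq⇒4duv≡p+u+v p>0 d>0 u>0 v>0 eq)))

proposition3 : ((p d u v : ℕ) → Prime p → p ≢ 2 → (p>0 : 0 < p) → (d>0 : 0 < d) → (u>0 : 0 < u) → (v>0 : 0 < v)
                 → ErdosStrausEq p d u v p>0 d>0 u>0 v>0 → d ≤ (p + 3) / 8)
               × (∃[ p ] ∃[ d ] ∃[ u ] ∃[ v ] (Prime p × p ≢ 2 × Σ (0 < p) λ p>0 → Σ (0 < d) λ d>0 → Σ (0 < u) λ u>0 → Σ (0 < v) λ v>0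
                 → ErdosStrausEq p d u v p>0 d>0 u>0 v>0 × d ≡ (p + 3) / 8))
proposition3 =
  (λ _ _ _ _ → ErdosStrausEq⇒d≤[p+3]/8) ,
  -- 4/5 = 1/2 + 1/5 + 1/10
  (5 , 1 , 1 , 2 , from-yes (prime? 5) , (λ ()) , z<s , z<s , z<s , z<s , refl , refl)
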